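{- For every graph $G$ with at least two vertices, $p(G)\ge 2$.
   Context: All graphs are finite and simple; digraphs are finite, without loops or multiple arcs. The competition graph $C(D)$ of a digraph $D$ has vertex set $V(D)$, and distinct $x,y$ are adjacent iff some $z$ has arcs $(x,z),(y,z)$ in $D$. The competition number $k(G)$ is the smallest $k\ge0$ such that $G$ together with $k$ new isolated vertices is the competition graph of an acyclic digraph. The primary predator index $p(G)$ is the maximum, over all acyclic digraphs $D$ whose competition graph is $G$ together with $k(G)$ isolated vertices, of the number of vertices of in-degree $0$ in $D$. -}

module Defs where

open import Data.Nat using (ℕ; zero; suc; _+_; _<_; _≤_)
open import Data.Fin using (Fin; zero; suc; splitAt)
open import Data.Bool using (Bool; true; false; not; _∧_; _∨_)
open import Data.Sum using (_⊎_; inj₁; inj₂)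
open import Data.Product using (Σ; ∃; _×_; _,_)
open import Relation.Nullary using (¬_)
open import Relation.Binary.PropositionalEquality using (_≡_; _≢_)
open import Relation.Binary.Construct.Closure.Transitive using (TransClosure)
open import Function.Bundles using (_⇔_)

record Graph (n : ℕ) : Set where
  field
    adj   : Fin n → Fin n → Bool
    sym   : ∀ x y → adj x y ≡ adj y x
    irrefl : ∀ x → adj x x ≡ false
open Graph public

record Digraph (m : ℕ) : Set where
  field
    arc      : Fin m → Fin m → Bool
    loopless : ∀ x → arc x x ≡ false
open Digraph public

Arc : ∀ {m} → Digraph m → Fin m → Fin m → Set
Arc D x y = arc D x y ≡ true

Acyclic : ∀ {m} → Digraph m → Set
Acyclic D = ∀ v → ¬ TransClosure (Arc D) v v

-- G together with k new isolated vertices, on vertex set Fin (n + k);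
-- the first n vertices are those of G, the last k are the new ones.
addIsolated : ∀ {n} → Graph n → (k : ℕ) → Fin (n + k) → Fin (n + k) → Bool
addIsolated {n} G k x y with splitAt n x | splitAt n y
... | inj₁ a | inj₁ b = adj G a b
... | _      | _      = false

IsCompetitionGraphOf : ∀ {m} → (Fin m → Fin m → Bool) → Digraph m → Set
IsCompetitionGraphOf {m} H D =
  ∀ x y → x ≢ y → (H x y ≡ true ⇔ ∃ λ (z : Fin m) → Arc D x z × Arc D y z)

Realizes : ∀ {n} → Graph n → (k : ℕ) → Digraph (n + k) → Set
Realizes G k D = Acyclic D × IsCompetitionGraphOf (addIsolated G k) D

IsCompetitionNumber : ∀ {n} → Graph n → ℕ → Set
IsCompetitionNumber {n} G k =
  (Σ (Digraph (n + k)) (Realizes G k)) ×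
  (∀ k′ → k′ < k → ¬ Σ (Digraph (n + k′)) (Realizes G k′))

anyFin : ∀ {m} → (Fin m → Bool) → Bool
anyFin {zero}  f = false
anyFin {suc m} f = f zero ∨ anyFin (λ i → f (suc i))

bool→ℕ : Bool → ℕ
bool→ℕ true  = 1
bool→ℕ false = 0

countFin : ∀ {m} → (Fin m → Bool) → ℕ
countFin {zero}  f = 0
countFin {suc m} f = bool→ℕ (f zero) + countFin (λ i → f (suc i))

inDegreeZero : ∀ {m} → Digraph m → Fin m → Bool
inDegreeZero D v = not (anyFin (λ u → arc D u v))

numSources : ∀ {m} → Digraph m → ℕ
numSources D = countFin (inDegreeZero D)

IsPrimaryPredatorIndex : ∀ {n} → Graph n → ℕ → Set
IsPrimaryPredatorIndex {n} G p =
  Σ ℕ λ k → IsCompetitionNumber G k ×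
    (Σ (Digraph (n + k)) (λ D → Realizes G k D × numSources D ≡ p)) ×
    (∀ (D : Digraph (n + k)) → Realizes G k D → numSources D ≤ p)

-- Let D be any acyclic digraph whose competition graph is G ∪ I_k, k = k(G); it
-- has m = n + k ≥ 2 vertices.  In a finite acyclic digraph every nonempty set of
-- vertices has a minimal element (no in-neighbour inside the set), since following
-- in-neighbours for ever would, by pigeonhole, close a cycle.  Take a minimal
-- element s of the whole vertex set (a source) and a minimal element w of
-- V ∖ {s}; then s is the only possible in-neighbour of w.  Delete the in-arcs of
-- w.  The result is still acyclic, and its competition graph is unchanged because
-- a vertex with at most one in-neighbour is never a common prey.  Now s and w are
-- two distinct sources, so by maximality of p we get p ≥ 2.
module Submission where

open import Defs hiding (sym)
open import Data.Nat using (ℕ; zero; suc; _+_; _≤_; z≤n; s≤s)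
open import Data.Nat.Properties using (≤-trans; m≤n+m; m≤m+n; n<1+n; +-comm; m≤n⇒∃[o]m+o≡n)
open import Data.Fin using (Fin; zero; suc; toℕ; punchIn)
open import Data.Fin.Properties using (_≟_; pigeonhole; ¬∀⟶∃¬; any?; all?; punchInᵢ≢i)
open import Data.Bool using (Bool; true; false)
open import Data.Bool.Properties using (¬-not) renaming (_≟_ to _≟ᵇ_)
open import Data.Product using (Σ; ∃; _×_; _,_; proj₁; proj₂)
open import Data.Unit using (tt)
open import Data.Empty using (⊥-elim)
open import Level using (Level)
open import Relation.Unary using (Pred; Decidable)
open import Relation.Nullary using (¬_; Dec; yes; no; contradiction)
open import Relation.Nullary.Decidable using (_×-dec_; _→-dec_; ¬?; decidable-stable)
open import Relation.Binary.PropositionalEquality using (_≡_; _≢_; refl; sym; trans; cong; subst)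
open import Relation.Binary.Construct.Closure.Transitive using (TransClosure; [_]; _∷_)
open import Function.Bundles using (mk⇔; Equivalence)

private
  variable
    m : ℕ
    ℓ : Level

Arc? : (D : Digraph m) → ∀ x y → Dec (Arc D x y)
Arc? D x y = arc D x y ≟ᵇ true

acyclic-⊆ : (D D′ : Digraph m) → (∀ {x y} → Arc D′ x y → Arc D x y) → Acyclic D → Acyclic D′
acyclic-⊆ D D′ sub acyclic v cycle = acyclic v (walk cycle)
  where
    walk : ∀ {x y} → TransClosure (Arc D′) x y → TransClosure (Arc D) x y
    walk [ a ]     = [ sub a ]
    walk (a ∷ as) = sub a ∷ walk as

-- A sequence of vertices with an arc from each term to the previous one
-- (an infinite walk traversed backwards) cannot exist in an acyclic digraph on
-- finitely many vertices: two of its first m + 1 terms coincide, closing a cycle.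
backward-walk-cycle : (D : Digraph m) (x : ℕ → Fin m) →
                      (∀ i → Arc D (x (suc i)) (x i)) → ¬ Acyclic D
backward-walk-cycle {m} D x step acyclic
  with pigeonhole (n<1+n m) (λ i → x (toℕ i))
... | i , j , i<j , xi≡xj with m≤n⇒∃[o]m+o≡n i<j
... | d , i+1+d≡j =
  acyclic (x (toℕ j)) (subst (TransClosure (Arc D) (x (toℕ j))) xi≡xj path-j-i)
  where
    path : ∀ d i → TransClosure (Arc D) (x (suc (d + i))) (x i)
    path zero    i = [ step i ]
    path (suc d) i = step (suc (d + i)) ∷ path d i

    path-j-i : TransClosure (Arc D) (x (toℕ j)) (x (toℕ i))
    path-j-i = subst (λ t → TransClosure (Arc D) (x t) (x (toℕ i)))
                     (trans (cong suc (+-comm d (toℕ i))) i+1+d≡j) (path d (toℕ i))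

MinimalIn : Digraph m → Pred (Fin m) ℓ → Fin m → Set ℓ
MinimalIn D S w = S w × (∀ u → S u → ¬ Arc D u w)

-- In an acyclic digraph every nonempty decidable vertex set has a minimal element.
-- Otherwise every vertex of S has an in-neighbour in S, and iterating this
-- choice yields a backward walk.
minimal-exists : (D : Digraph m) → Acyclic D → {S : Pred (Fin m) ℓ} → Decidable S →
                 ∃ S → ∃ (MinimalIn D S)
minimal-exists {m} D acyclic {S} S? (w₀ , w₀∈S) with any? minimal?
  where
    minimal? : Decidable (MinimalIn D S)
    minimal? w = S? w ×-dec all? (λ u → S? u →-dec ¬? (Arc? D u w))
... | yes found = found
... | no none   = ⊥-elim (backward-walk-cycle D (λ i → proj₁ (walk i)) step acyclic)
  where
    predecessor : ∀ w → S w → ∃ λ u → S u × Arc D u w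
    predecessor w w∈S with ¬∀⟶∃¬ m _ (λ u → S? u →-dec ¬? (Arc? D u w))
                                     (λ noPred → none (w , w∈S , noPred))
    ... | u , ¬[u∈S⇒¬arc] with S? u
    ...   | yes u∈S = u , u∈S , decidable-stable (Arc? D u w) (λ ¬arc → ¬[u∈S⇒¬arc] (λ _ → ¬arc))
    ...   | no  u∉S = contradiction (λ u∈S → ⊥-elim (u∉S u∈S)) ¬[u∈S⇒¬arc]

    walk : ℕ → Σ (Fin m) S
    walk zero    = w₀ , w₀∈S
    walk (suc i) = let u , u∈S , _ = predecessor (proj₁ (walk i)) (proj₂ (walk i)) in u , u∈S

    step : ∀ i → Arc D (proj₁ (walk (suc i))) (proj₁ (walk i))
    step i = proj₂ (proj₂ (predecessor (proj₁ (walk i)) (proj₂ (walk i))))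

module ClearInArcs (D : Digraph m) (w : Fin m) where

  arc′ : Fin m → Fin m → Bool
  arc′ x y with y ≟ w
  ... | yes _ = false
  ... | no  _ = arc D x y

  loopless′ : ∀ x → arc′ x x ≡ false
  loopless′ x with x ≟ w
  ... | yes _ = refl
  ... | no  _ = loopless D x

  cleared : Digraph m
  cleared = record { arc = arc′ ; loopless = loopless′ }

  cleared-⊆ : ∀ {x y} → Arc cleared x y → Arc D x y
  cleared-⊆ {x} {y} a with y ≟ w
  ... | no _ = a

  cleared-keeps : ∀ {x y} → y ≢ w → Arc D x y → Arc cleared x y
  cleared-keeps {x} {y} y≢w a with y ≟ w
  ... | yes y≡w = contradiction y≡w y≢w
  ... | no  _   = a

  cleared-into-w : ∀ x → ¬ Arc cleared x w
  cleared-into-w x a with w ≟ w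
  ... | yes _   = contradiction a (λ ())
  ... | no  w≢w = w≢w refl

  -- If w has at most one in-neighbour it is never a common prey, so deleting its
  -- in-arcs leaves the competition graph unchanged.
  cleared-competition : (∀ {x y} → Arc D x w → Arc D y w → x ≡ y) →
                        ∀ {H : Fin m → Fin m → Bool} → IsCompetitionGraphOf H D → IsCompetitionGraphOf H cleared
  cleared-competition unique-pred {H} competition x y x≢y = mk⇔ keep restrict
    where
      keep : H x y ≡ true → ∃ λ z → Arc cleared x z × Arc cleared y z
      keep xy with Equivalence.to (competition x y x≢y) xy
      ... | z , xz , yz = z , cleared-keeps z≢w xz , cleared-keeps z≢w yz
        where
          z≢w : z ≢ w
          z≢w refl = x≢y (unique-pred xz yz)
      restrict : (∃ λ z → Arc cleared x z × Arc cleared y z) → H x y ≡ true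
      restrict (z , xz , yz) = Equivalence.from (competition x y x≢y) (z , cleared-⊆ xz , cleared-⊆ yz)

IsSource : Digraph m → Fin m → Set
IsSource D v = ∀ u → ¬ Arc D u v

anyFin-none : (f : Fin m → Bool) → (∀ i → f i ≡ false) → anyFin f ≡ false
anyFin-none {zero}  f none = refl
anyFin-none {suc m} f none rewrite none zero = anyFin-none (λ i → f (suc i)) (λ i → none (suc i))

source-inDegreeZero : (D : Digraph m) {v : Fin m} → IsSource D v → inDegreeZero D v ≡ true
source-inDegreeZero D {v} source
  rewrite anyFin-none (λ u → arc D u v) (λ u → ¬-not (source u)) = refl

countFin-one : (f : Fin m → Bool) (u : Fin m) → f u ≡ true → 1 ≤ countFin f
countFin-one f zero    fu rewrite fu = s≤s z≤n
countFin-one f (suc u) fu = ≤-trans (countFin-one (λ i → f (suc i)) u fu) (m≤n+m _ _)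

countFin-two : (f : Fin m → Bool) {u w : Fin m} → u ≢ w → f u ≡ true → f w ≡ true →
               2 ≤ countFin f
countFin-two f {zero}  {zero}  u≢w _  _  = contradiction refl u≢w
countFin-two f {zero}  {suc w} _   fu fw rewrite fu = s≤s (countFin-one (λ i → f (suc i)) w fw)
countFin-two f {suc u} {zero}  _   fu fw rewrite fw = s≤s (countFin-one (λ i → f (suc i)) u fu)
countFin-two f {suc u} {suc w} u≢w fu fw =
  ≤-trans (countFin-two (λ i → f (suc i)) (λ u≡w → u≢w (cong suc u≡w)) fu fw) (m≤n+m _ _)

two-sources : (D : Digraph m) {u w : Fin m} → u ≢ w → IsSource D u → IsSource D w →
              2 ≤ numSources D
two-sources D u≢w su sw =
  countFin-two (inDegreeZero D) u≢w (source-inDegreeZero D su) (source-inDegreeZero D sw)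

realization-with-two-sources :
  ∀ {H : Fin m → Fin m → Bool} → 2 ≤ m → (D : Digraph m) → Acyclic D → IsCompetitionGraphOf H D →
  Σ (Digraph m) λ D′ → (Acyclic D′ × IsCompetitionGraphOf H D′) × 2 ≤ numSources D′
realization-with-two-sources {suc (suc _)} (s≤s (s≤s z≤n)) D acyclic competition
  with minimal-exists D acyclic (λ _ → yes tt) (zero , tt)
... | s , _ , s-source
  with minimal-exists D acyclic (λ u → ¬? (u ≟ s)) (punchIn s zero , punchInᵢ≢i s zero)
... | w , w≢s , w-minimal =
  cleared , (acyclic-⊆ D cleared cleared-⊆ acyclic , cleared-competition only-s-enters-w competition) ,
  two-sources cleared (λ s≡w → w≢s (sym s≡w))
    (λ u a → s-source u tt (cleared-⊆ a)) cleared-into-w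
  where
    open ClearInArcs D w
    is-s : ∀ {u} → Arc D u w → u ≡ s
    is-s {u} a = decidable-stable (u ≟ s) (λ u≢s → w-minimal u u≢s a)
    only-s-enters-w : ∀ {x y} → Arc D x w → Arc D y w → x ≡ y
    only-s-enters-w xw yw = trans (is-s xw) (sym (is-s yw))

proposition3p1 : ∀ {n} (G : Graph n) → 2 ≤ n → ∀ p → IsPrimaryPredatorIndex G p → 2 ≤ p
proposition3p1 {n} G 2≤n p (k , _ , (D , (acyclic , competition) , _) , maximal)
  with realization-with-two-sources (≤-trans 2≤n (m≤m+n n k)) D acyclic competition
... | D′ , realizes , two≤sources = ≤-trans two≤sources (maximal D′ realizes)
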